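{- Let $X=\{x_1,\dots,x_9\}$ be a set of nine pairwise distinct positive integers with $\sum_{i=1}^9 1/x_i=1$, at least one of which is even, and let $\alpha_2=\max_i v_2(x_i)$. (i) If $2\notin X$, $\alpha_2=2$, and $x_1\cdots x_9$ has exactly two prime divisors, then $X$ is one of the five sets $\{3,4,6,9,12,36,54,162,324\}$, $\{3,4,6,9,12,27,108,162,324\}$, $\{3,4,6,9,12,36,81,108,162\}$, $\{3,4,6,9,12,27,81,243,486\}$, $\{3,4,6,9,18,27,36,81,162\}$, and each of these is a solution. (ii) Suppose $2\in X$ and $\alpha_2=2$. If every element of $X$ is of the form $2^a q^b$ ($a,b\geq 0$) for a fixed odd prime $q\neq 3$, then $X$ is either $\{2,4,7,14,49,98,343,686,1372\}$ or $\{2,4,5,25,125,625,3125,15625,62500\}$ (both are solutions). If every element of $X$ is of the form $2^a3^b$, then $X$ is one of the following $46$ sets (all of which are solutions): {2,4,9,12,27,81,243,729,1458}, {2,4,6,27,36,81,243,729,1458}, {2,3,12,27,36,81,243,729,1458}, {2,4,6,18,81,108,243,729,1458}, {2,3,12,18,81,108,243,729,1458}, {2,3,9,36,81,108,243,729,1458}, {2,4,9,18,27,36,81,243,486}, {2,4,6,18,54,243,324,729,1458}, {2,3,12,18,54,243,324,729,1458}, {2,3,9,36,54,243,324,729,1458}, {2,3,9,27,108,243,324,729,1458}, {2,4,9,12,36,81,108,243,486}, {2,4,6,27,54,81,108,243,486}, {2,3,12,27,54,81,108,243,486}, {2,6,9,12,18,27,36,81,162}, {2,4,6,18,54,162,729,972,1458},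 {2,3,12,18,54,162,729,972,1458}, {2,3,9,36,54,162,729,972,1458}, {2,3,9,27,108,162,729,972,1458}, {2,4,9,12,36,54,243,324,486}, {2,3,9,27,81,324,729,972,1458}, {2,4,9,12,27,108,243,324,486}, {2,4,6,27,36,108,243,324,486}, {2,3,12,27,36,108,243,324,486}, {2,4,6,18,81,162,243,324,486}, {2,3,12,18,81,162,243,324,486}, {2,3,9,36,81,162,243,324,486}, {2,4,9,18,27,54,81,108,162}, {2,3,18,27,36,54,81,108,162}, {2,4,6,18,54,162,486,1458,2916}, {2,3,12,18,54,162,486,1458,2916}, {2,3,9,36,54,162,486,1458,2916}, {2,3,9,27,108,162,486,1458,2916}, {2,4,9,12,36,54,162,486,972}, {2,3,9,27,81,324,486,1458,2916}, {2,4,9,12,27,108,162,486,972}, {2,4,6,27,36,108,162,486,972}, {2,3,12,27,36,108,162,486,972}, {2,3,9,27,81,243,972,1458,2916}, {2,4,9,12,27,81,324,486,972}, {2,4,6,27,36,81,324,486,972}, {2,3,12,27,36,81,324,486,972}, {2,4,6,18,81,108,324,486,972}, {2,3,12,18,81,108,324,486,972}, {2,3,9,36,81,108,324,486,972}, {2,4,9,18,27,36,108,162,324}.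
   Context: $v_2$ denotes the $2$-adic valuation. Sets are unordered. -}

module Defs where

open import Data.Nat using (ℕ; zero; suc; _⊔_; _<_; _*_; _^_)
open import Data.Nat.DivMod using (_%_; _/_)
open import Data.Nat.Divisibility using (_∣_)
open import Data.Nat.Primality using (Prime)
open import Data.Integer using (+_)
open import Data.Rational as ℚ using (ℚ; 0ℚ; 1ℚ)
open import Data.List using (List; []; _∷_; foldr; map; length)
open import Data.List.Relation.Unary.All using (All)
open import Data.List.Relation.Unary.Unique.Propositional using (Unique)
open import Relation.Binary.PropositionalEquality using (_≡_)
open import Data.Product using (_×_; Σ; ∃)
open import Data.Sum using (_⊎_)
open import Function.Bundles using (_⇔_)
open import Relation.Nullary using (¬_)

-- 2-adic valuation (with the convention v₂ 0 = 0, irrelevant here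
-- since all elements are positive).  Fuel-based recursion on n.
v₂-aux : ℕ → ℕ → ℕ
v₂-aux zero    n       = 0
v₂-aux (suc k) zero    = 0
v₂-aux (suc k) (suc m) with suc m % 2
... | zero  = suc (v₂-aux k (suc m / 2))
... | suc _ = 0

v₂ : ℕ → ℕ
v₂ n = v₂-aux n n

maxList : List ℕ → ℕ
maxList = foldr _⊔_ 0

α₂ : List ℕ → ℕ
α₂ X = maxList (map v₂ X)

-- reciprocal of a positive integer as a rational (1/0 := 0 by convention,
-- never used since elements are assumed positive)
recip : ℕ → ℚ
recip zero    = 0ℚ
recip (suc n) = + 1 ℚ./ suc n

recipSum : List ℕ → ℚ
recipSum X = foldr (λ x s → recip x ℚ.+ s) 0ℚ X

prod : List ℕ → ℕ
prod = foldr _*_ 1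

-- X (a finite set, represented by a duplicate-free list) is a set of nine
-- pairwise distinct positive integers with ∑ 1/x = 1.
IsSolution : List ℕ → Set
IsSolution X = length X ≡ 9 × Unique X × All (λ x → 0 < x) X × recipSum X ≡ 1ℚ

ExactlyTwoPrimeDivisors : ℕ → Set
ExactlyTwoPrimeDivisors n =
  Σ ℕ λ p → Σ ℕ λ q → Prime p × Prime q × ¬ (p ≡ q) ×
    ((r : ℕ) → Prime r → (r ∣ n ⇔ (r ≡ p ⊎ r ≡ q)))

listI : List (List ℕ)
listI =
  ( 3 ∷ 4 ∷ 6 ∷ 9 ∷ 12 ∷ 36 ∷ 54 ∷ 162 ∷ 324 ∷ [] )
  ∷   ( 3 ∷ 4 ∷ 6 ∷ 9 ∷ 12 ∷ 27 ∷ 108 ∷ 162 ∷ 324 ∷ [] )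
  ∷   ( 3 ∷ 4 ∷ 6 ∷ 9 ∷ 12 ∷ 36 ∷ 81 ∷ 108 ∷ 162 ∷ [] )
  ∷   ( 3 ∷ 4 ∷ 6 ∷ 9 ∷ 12 ∷ 27 ∷ 81 ∷ 243 ∷ 486 ∷ [] )
  ∷   ( 3 ∷ 4 ∷ 6 ∷ 9 ∷ 18 ∷ 27 ∷ 36 ∷ 81 ∷ 162 ∷ [] )
  ∷ []

listIIq : List (List ℕ)
listIIq =
  ( 2 ∷ 4 ∷ 7 ∷ 14 ∷ 49 ∷ 98 ∷ 343 ∷ 686 ∷ 1372 ∷ [] )
  ∷   ( 2 ∷ 4 ∷ 5 ∷ 25 ∷ 125 ∷ 625 ∷ 3125 ∷ 15625 ∷ 62500 ∷ [] )
  ∷ []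

listII3 : List (List ℕ)
listII3 =
  ( 2 ∷ 4 ∷ 9 ∷ 12 ∷ 27 ∷ 81 ∷ 243 ∷ 729 ∷ 1458 ∷ [] )
  ∷   ( 2 ∷ 4 ∷ 6 ∷ 27 ∷ 36 ∷ 81 ∷ 243 ∷ 729 ∷ 1458 ∷ [] )
  ∷   ( 2 ∷ 3 ∷ 12 ∷ 27 ∷ 36 ∷ 81 ∷ 243 ∷ 729 ∷ 1458 ∷ [] )
  ∷   ( 2 ∷ 4 ∷ 6 ∷ 18 ∷ 81 ∷ 108 ∷ 243 ∷ 729 ∷ 1458 ∷ [] )
  ∷   ( 2 ∷ 3 ∷ 12 ∷ 18 ∷ 81 ∷ 108 ∷ 243 ∷ 729 ∷ 1458 ∷ [] )
  ∷   ( 2 ∷ 3 ∷ 9 ∷ 36 ∷ 81 ∷ 108 ∷ 243 ∷ 729 ∷ 1458 ∷ [] )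
  ∷   ( 2 ∷ 4 ∷ 9 ∷ 18 ∷ 27 ∷ 36 ∷ 81 ∷ 243 ∷ 486 ∷ [] )
  ∷   ( 2 ∷ 4 ∷ 6 ∷ 18 ∷ 54 ∷ 243 ∷ 324 ∷ 729 ∷ 1458 ∷ [] )
  ∷   ( 2 ∷ 3 ∷ 12 ∷ 18 ∷ 54 ∷ 243 ∷ 324 ∷ 729 ∷ 1458 ∷ [] )
  ∷   ( 2 ∷ 3 ∷ 9 ∷ 36 ∷ 54 ∷ 243 ∷ 324 ∷ 729 ∷ 1458 ∷ [] )
  ∷   ( 2 ∷ 3 ∷ 9 ∷ 27 ∷ 108 ∷ 243 ∷ 324 ∷ 729 ∷ 1458 ∷ [] )
  ∷   ( 2 ∷ 4 ∷ 9 ∷ 12 ∷ 36 ∷ 81 ∷ 108 ∷ 243 ∷ 486 ∷ [] )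
  ∷   ( 2 ∷ 4 ∷ 6 ∷ 27 ∷ 54 ∷ 81 ∷ 108 ∷ 243 ∷ 486 ∷ [] )
  ∷   ( 2 ∷ 3 ∷ 12 ∷ 27 ∷ 54 ∷ 81 ∷ 108 ∷ 243 ∷ 486 ∷ [] )
  ∷   ( 2 ∷ 6 ∷ 9 ∷ 12 ∷ 18 ∷ 27 ∷ 36 ∷ 81 ∷ 162 ∷ [] )
  ∷   ( 2 ∷ 4 ∷ 6 ∷ 18 ∷ 54 ∷ 162 ∷ 729 ∷ 972 ∷ 1458 ∷ [] )
  ∷   ( 2 ∷ 3 ∷ 12 ∷ 18 ∷ 54 ∷ 162 ∷ 729 ∷ 972 ∷ 1458 ∷ [] )
  ∷   ( 2 ∷ 3 ∷ 9 ∷ 36 ∷ 54 ∷ 162 ∷ 729 ∷ 972 ∷ 1458 ∷ [] )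
  ∷   ( 2 ∷ 3 ∷ 9 ∷ 27 ∷ 108 ∷ 162 ∷ 729 ∷ 972 ∷ 1458 ∷ [] )
  ∷   ( 2 ∷ 4 ∷ 9 ∷ 12 ∷ 36 ∷ 54 ∷ 243 ∷ 324 ∷ 486 ∷ [] )
  ∷   ( 2 ∷ 3 ∷ 9 ∷ 27 ∷ 81 ∷ 324 ∷ 729 ∷ 972 ∷ 1458 ∷ [] )
  ∷   ( 2 ∷ 4 ∷ 9 ∷ 12 ∷ 27 ∷ 108 ∷ 243 ∷ 324 ∷ 486 ∷ [] )
  ∷   ( 2 ∷ 4 ∷ 6 ∷ 27 ∷ 36 ∷ 108 ∷ 243 ∷ 324 ∷ 486 ∷ [] )
  ∷   ( 2 ∷ 3 ∷ 12 ∷ 27 ∷ 36 ∷ 108 ∷ 243 ∷ 324 ∷ 486 ∷ [] )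
  ∷   ( 2 ∷ 4 ∷ 6 ∷ 18 ∷ 81 ∷ 162 ∷ 243 ∷ 324 ∷ 486 ∷ [] )
  ∷   ( 2 ∷ 3 ∷ 12 ∷ 18 ∷ 81 ∷ 162 ∷ 243 ∷ 324 ∷ 486 ∷ [] )
  ∷   ( 2 ∷ 3 ∷ 9 ∷ 36 ∷ 81 ∷ 162 ∷ 243 ∷ 324 ∷ 486 ∷ [] )
  ∷   ( 2 ∷ 4 ∷ 9 ∷ 18 ∷ 27 ∷ 54 ∷ 81 ∷ 108 ∷ 162 ∷ [] )
  ∷   ( 2 ∷ 3 ∷ 18 ∷ 27 ∷ 36 ∷ 54 ∷ 81 ∷ 108 ∷ 162 ∷ [] )
  ∷   ( 2 ∷ 4 ∷ 6 ∷ 18 ∷ 54 ∷ 162 ∷ 486 ∷ 1458 ∷ 2916 ∷ [] )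
  ∷   ( 2 ∷ 3 ∷ 12 ∷ 18 ∷ 54 ∷ 162 ∷ 486 ∷ 1458 ∷ 2916 ∷ [] )
  ∷   ( 2 ∷ 3 ∷ 9 ∷ 36 ∷ 54 ∷ 162 ∷ 486 ∷ 1458 ∷ 2916 ∷ [] )
  ∷   ( 2 ∷ 3 ∷ 9 ∷ 27 ∷ 108 ∷ 162 ∷ 486 ∷ 1458 ∷ 2916 ∷ [] )
  ∷   ( 2 ∷ 4 ∷ 9 ∷ 12 ∷ 36 ∷ 54 ∷ 162 ∷ 486 ∷ 972 ∷ [] )
  ∷   ( 2 ∷ 3 ∷ 9 ∷ 27 ∷ 81 ∷ 324 ∷ 486 ∷ 1458 ∷ 2916 ∷ [] )
  ∷   ( 2 ∷ 4 ∷ 9 ∷ 12 ∷ 27 ∷ 108 ∷ 162 ∷ 486 ∷ 972 ∷ [] )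
  ∷   ( 2 ∷ 4 ∷ 6 ∷ 27 ∷ 36 ∷ 108 ∷ 162 ∷ 486 ∷ 972 ∷ [] )
  ∷   ( 2 ∷ 3 ∷ 12 ∷ 27 ∷ 36 ∷ 108 ∷ 162 ∷ 486 ∷ 972 ∷ [] )
  ∷   ( 2 ∷ 3 ∷ 9 ∷ 27 ∷ 81 ∷ 243 ∷ 972 ∷ 1458 ∷ 2916 ∷ [] )
  ∷   ( 2 ∷ 4 ∷ 9 ∷ 12 ∷ 27 ∷ 81 ∷ 324 ∷ 486 ∷ 972 ∷ [] )
  ∷   ( 2 ∷ 4 ∷ 6 ∷ 27 ∷ 36 ∷ 81 ∷ 324 ∷ 486 ∷ 972 ∷ [] )
  ∷   ( 2 ∷ 3 ∷ 12 ∷ 27 ∷ 36 ∷ 81 ∷ 324 ∷ 486 ∷ 972 ∷ [] )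
  ∷   ( 2 ∷ 4 ∷ 6 ∷ 18 ∷ 81 ∷ 108 ∷ 324 ∷ 486 ∷ 972 ∷ [] )
  ∷   ( 2 ∷ 3 ∷ 12 ∷ 18 ∷ 81 ∷ 108 ∷ 324 ∷ 486 ∷ 972 ∷ [] )
  ∷   ( 2 ∷ 3 ∷ 9 ∷ 36 ∷ 81 ∷ 108 ∷ 324 ∷ 486 ∷ 972 ∷ [] )
  ∷   ( 2 ∷ 4 ∷ 9 ∷ 18 ∷ 27 ∷ 36 ∷ 108 ∷ 162 ∷ 324 ∷ [] )
  ∷ []

{-# OPTIONS --termination-depth=2 #-}
-- Write every element as 2^a q^b.  As α₂ = 2 we have a ≤ 2, and if B is the largest exponent
-- of q, multiplying ∑ 1/x = 1 by 4 q^B turns it into the identity  ∑ 2^(2-a) q^(B-b) = 4 q^B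
-- in ℕ.  Remove the elements level by level, b = 0, 1, 2, …: when level k is reached, the
-- remaining terms add up to r · q^(B-k) and each of them is at most 4 q^(B-k), so r ≤ 4 · (number
-- of remaining elements), while moving on to the next level multiplies r by q.  Hence for each q
-- the exponents lie in a finite search tree, and q ≥ 37 is impossible: leaving level 0 with
-- elements still to place already gives r ≥ q > 4 · 9.  The tree is enumerated for the odd
-- primes below 37 and each leaf is compared with the lists of the statement by computation.
module Submission where

open import Defs
open import Data.Bool using (true; if_then_else_)
open import Data.Integer as ℤ using (+_)
import Data.Integer.Properties as ℤₚ
import Data.Integer.Tactic.RingSolver as ℤ-Solver
open import Data.List using (List; []; _∷_; [_]; _++_; map; length; upTo)
import Data.List.Properties as Listₚ
open import Data.List.Membership.Propositional using (_∈_; _∉_; find)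
open import Data.List.Membership.Propositional.Properties
  using (∈-map⁺; ∈-++⁺ˡ; ∈-++⁺ʳ; ∈-∃++; ∈-upTo⁺)
open import Data.List.Relation.Binary.Permutation.Propositional
  using (_↭_; ↭-refl; ↭-sym; ↭-trans; ↭-prep; ↭-reflexive; ↭⇒↭ₛ)
open import Data.List.Relation.Binary.Permutation.Propositional.Properties
  using (All-resp-↭; Any-resp-↭; ∈-resp-↭; ↭-length; shift)
import Data.List.Relation.Binary.Permutation.Propositional.Properties as ↭
open import Data.List.Relation.Unary.All as All using (All; []; _∷_; all?)
open import Data.List.Relation.Unary.AllPairs using (_∷_)
open import Data.List.Relation.Unary.Any as Any using (Any; here; there; any?)
import Data.List.Relation.Unary.Any.Properties as Anyₚ
open import Data.List.Relation.Unary.Unique.Propositional using (Unique)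
open import Data.List.Relation.Unary.Unique.Propositional.Properties using (map⁻)
open import Data.Nat as ℕ
  using (ℕ; zero; suc; _+_; _*_; _∸_; _^_; _≤_; _<_; _≤?_; _<?_; s≤s; z≤n; NonZero; NonTrivial)
open import Data.Nat.DivMod using (_%_; _/_; m%n<n; m*n%n≡0; m*n/n≡m; %-distribˡ-*)
open import Data.Nat.Divisibility using (_∣_; ∣-trans; m%n≡0⇒n∣m)
open import Data.Nat.ListAction using (sum; product)
open import Data.Nat.ListAction.Properties using (sum-↭; ∈⇒∣product)
open import Data.Nat.Primality
  using (Prime; prime?; prime[2]; prime⇒irreducible; prime⇒nonTrivial)
open import Data.Nat.Primality.Factorisation using (factorise)
import Data.Nat.Properties as ℕₚ
import Data.Nat.Tactic.RingSolver as ℕ-Solver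
open import Data.Product using (_×_; _,_; ∃; proj₁; proj₂)
import Data.Product.Properties as Productₚ
open import Data.Rational as ℚ using (1ℚ; toℚᵘ)
import Data.Rational.Properties as ℚₚ
open import Data.Rational.Unnormalised as ℚᵘ using (ℚᵘ; mkℚᵘ; *≡*; _≃_)
import Data.Rational.Unnormalised.Properties as ℚᵘₚ
open import Data.Sum using (_⊎_; inj₁; inj₂; swap)
open import Function using (_∘_)
open import Function.Bundles using (Equivalence)
open import Relation.Binary.PropositionalEquality hiding ([_])
open import Relation.Nullary using (¬_; ¬?; does; yes; no; contradiction; _→-dec_; _×-dec_)
open import Relation.Nullary.Decidable using (dec-true; toWitness)
open import Relation.Unary using (Decidable)

open import Algebra.Properties.CommutativeSemigroup ℕₚ.*-commutativeSemigroup
  using (x∙yz≈y∙xz; interchange)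
open import Data.List.Relation.Unary.Unique.DecPropositional ℕ._≟_ using (unique?)
open import Data.List.Sort.InsertionSort ℕₚ.≤-decTotalOrder using (sort)
open import Data.List.Sort.InsertionSort.Properties ℕₚ.≤-decTotalOrder using (sort-↭)
open import Data.List.Relation.Binary.Permutation.Setoid.Properties (setoid (ℕ × ℕ))
  using (Unique-resp-↭)

m*o+n≡k*o⇒m≤k : ∀ m n k o .{{_ : NonZero o}} → m * o + n ≡ k * o → m ≤ k
m*o+n≡k*o⇒m≤k m n k o eq = ℕₚ.*-cancelʳ-≤ m k o (subst (m * o ≤_) eq (ℕₚ.m≤m+n (m * o) n))

m*o+n≡k*o⇒n≡[k∸m]*o : ∀ m n k o → m * o + n ≡ k * o → n ≡ (k ∸ m) * o
m*o+n≡k*o⇒n≡[k∸m]*o m n k o eq = begin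
  n                 ≡⟨ ℕₚ.m+n∸m≡n (m * o) n ⟨
  m * o + n ∸ m * o ≡⟨ cong (_∸ m * o) eq ⟩
  k * o ∸ m * o     ≡⟨ ℕₚ.*-distribʳ-∸ o k m ⟨
  (k ∸ m) * o       ∎
  where open ≡-Reasoning

m<n⇒n∸m≡1+n∸1+m : ∀ {m n} → m < n → n ∸ m ≡ suc (n ∸ suc m)
m<n⇒n∸m≡1+n∸1+m {zero}  {suc n} _         = refl
m<n⇒n∸m≡1+n∸1+m {suc m} {suc n} (s≤s m<n) = m<n⇒n∸m≡1+n∸1+m m<n

m<n+1+m : ∀ m n → m < n + suc m
m<n+1+m m n = subst (m <_) (sym (ℕₚ.+-suc n m)) (s≤s (ℕₚ.m≤n+m m n))

n<2^n : ∀ n → n < 2 ^ n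
n<2^n zero    = s≤s z≤n
n<2^n (suc n) = ℕₚ.+-mono-≤-< (ℕₚ.m^n>0 2 n) (ℕₚ.<-≤-trans (n<2^n n) (ℕₚ.m≤m+n (2 ^ n) 0))

2^[2∸a]≤4 : ∀ a → 2 ^ (2 ∸ a) ≤ 4
2^[2∸a]≤4 a = ℕₚ.^-monoʳ-≤ 2 (ℕₚ.m∸n≤m 2 a)

sum-map-≤ : ∀ {A : Set} (f : A → ℕ) {c ys} → All (λ y → f y ≤ c) ys →
  sum (map f ys) ≤ length ys * c
sum-map-≤ f []             = z≤n
sum-map-≤ f (fy≤c ∷ fys≤c) = ℕₚ.+-mono-≤ fy≤c (sum-map-≤ f fys≤c)

∈-if : ∀ {A : Set} {b} {x : A} {xs} → b ≡ true → x ∈ xs → x ∈ (if b then xs else [])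
∈-if refl x∈xs = x∈xs

-- Clearing denominators

private
  ⟦_⟧ : ℕ → ℚᵘ
  ⟦ n ⟧ = mkℚᵘ (+ n) 0

  ⟦⟧-+ : ∀ m n → ⟦ m ⟧ ℚᵘ.+ ⟦ n ⟧ ≃ ⟦ m + n ⟧
  ⟦⟧-+ m n = *≡* (trans (lem (+ m) (+ n)) (cong (ℤ._* + 1) (sym (ℤₚ.pos-+ m n))))
    where
    lem : ∀ x y → (x ℤ.* + 1 ℤ.+ y ℤ.* + 1) ℤ.* + 1 ≡ (x ℤ.+ y) ℤ.* + 1
    lem = ℤ-Solver.solve-∀

  ⟦⟧-injective : ∀ {m n} → ⟦ m ⟧ ≃ ⟦ n ⟧ → m ≡ n
  ⟦⟧-injective {m} {n} (*≡* eq) =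
    ℤₚ.+-injective (trans (sym (ℤₚ.*-identityʳ (+ m))) (trans eq (ℤₚ.*-identityʳ (+ n))))

  recip-*-cancel : ∀ x w → 0 < x → toℚᵘ (recip x) ℚᵘ.* ⟦ x * w ⟧ ≃ ⟦ w ⟧
  recip-*-cancel (suc n) w _ =
    ℚᵘₚ.≃-trans (ℚᵘₚ.*-congʳ (ℚₚ.toℚᵘ-fromℚᵘ (mkℚᵘ (+ 1) n))) (*≡* (begin
    (+ 1 ℤ.* + (suc n * w)) ℤ.* + 1 ≡⟨ trans (ℤₚ.*-identityʳ _) (ℤₚ.*-identityˡ _) ⟩
    + (suc n * w)                   ≡⟨ cong +_ (lem n w) ⟩
    + (w * suc (n * 1))             ≡⟨ ℤₚ.pos-* w (suc (n * 1)) ⟩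
    + w ℤ.* + suc (n * 1)           ∎))
    where
    open ≡-Reasoning
    lem : ∀ n w → suc n * w ≡ w * suc (n * 1)
    lem = ℕ-Solver.solve-∀

module _ {A : Set} (f g : A → ℕ) {M : ℕ} where

  private
    toℚᵘ-recipSum-* : ∀ ys → All (λ y → f y * g y ≡ M) ys → All (0 <_) (map f ys) →
      toℚᵘ (recipSum (map f ys)) ℚᵘ.* ⟦ M ⟧ ≃ ⟦ sum (map g ys) ⟧
    toℚᵘ-recipSum-* [] [] [] = ℚᵘₚ.*-zeroˡ ⟦ M ⟧
    toℚᵘ-recipSum-* (y ∷ ys) (fg≡M ∷ fgs≡M) (fy>0 ∷ fys>0) = begin
      toℚᵘ (recip (f y) ℚ.+ recipSum (map f ys)) ℚᵘ.* ⟦ M ⟧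
        ≈⟨ ℚᵘₚ.*-congʳ (ℚₚ.toℚᵘ-homo-+ (recip (f y)) _) ⟩
      (toℚᵘ (recip (f y)) ℚᵘ.+ toℚᵘ (recipSum (map f ys))) ℚᵘ.* ⟦ M ⟧
        ≈⟨ ℚᵘₚ.*-distribʳ-+ ⟦ M ⟧ (toℚᵘ (recip (f y))) _ ⟩
      toℚᵘ (recip (f y)) ℚᵘ.* ⟦ M ⟧ ℚᵘ.+ toℚᵘ (recipSum (map f ys)) ℚᵘ.* ⟦ M ⟧
        ≈⟨ ℚᵘₚ.+-cong (subst (λ m → toℚᵘ (recip (f y)) ℚᵘ.* ⟦ m ⟧ ≃ ⟦ g y ⟧) fg≡M
                        (recip-*-cancel (f y) (g y) fy>0))
                     (toℚᵘ-recipSum-* ys fgs≡M fys>0) ⟩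
      ⟦ g y ⟧ ℚᵘ.+ ⟦ sum (map g ys) ⟧
        ≈⟨ ⟦⟧-+ (g y) _ ⟩
      ⟦ g y + sum (map g ys) ⟧ ∎
      where
      open ℚᵘₚ.≃-Reasoning

  recipSum≡1⇒sum-cofactors≡ : ∀ ys → All (λ y → f y * g y ≡ M) ys → All (0 <_) (map f ys) →
    recipSum (map f ys) ≡ 1ℚ → sum (map g ys) ≡ M
  recipSum≡1⇒sum-cofactors≡ ys fg≡M f>0 sum≡1 = ⟦⟧-injective (begin
    ⟦ sum (map g ys) ⟧                          ≈⟨ toℚᵘ-recipSum-* ys fg≡M f>0 ⟨
    toℚᵘ (recipSum (map f ys)) ℚᵘ.* ⟦ M ⟧      ≡⟨ cong (λ s → toℚᵘ s ℚᵘ.* ⟦ M ⟧) sum≡1 ⟩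
    toℚᵘ 1ℚ ℚᵘ.* ⟦ M ⟧                         ≈⟨ ℚᵘₚ.*-identityˡ ⟦ M ⟧ ⟩
    ⟦ M ⟧                                       ∎)
    where open ℚᵘₚ.≃-Reasoning

-- The 2-adic valuation and numbers of the form 2^a q^b

private
  v₂-aux-even : ∀ f n {m} → 0 < n → n % 2 ≡ 0 → n / 2 ≡ m →
    v₂-aux (suc f) n ≡ suc (v₂-aux f m)
  v₂-aux-even f (suc n) _ n%2≡0 refl with suc n % 2 | n%2≡0
  ... | .0 | refl = refl

  v₂-aux-odd : ∀ f n → n % 2 ≡ 1 → v₂-aux f n ≡ 0
  v₂-aux-odd zero    n       _       = refl
  v₂-aux-odd (suc f) (suc n) n%2≡1 with suc n % 2 | n%2≡1
  ... | .1 | refl = refl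

  odd⇒0< : ∀ {m} → m % 2 ≡ 1 → 0 < m
  odd⇒0< {suc _} _ = s≤s z≤n

  v₂-aux-2^a*odd : ∀ a f {m} → m % 2 ≡ 1 → a ≤ f → v₂-aux f (2 ^ a * m) ≡ a
  v₂-aux-2^a*odd zero    f       {m} m%2≡1 _ rewrite ℕₚ.*-identityˡ m = v₂-aux-odd f m m%2≡1
  v₂-aux-2^a*odd (suc a) (suc f) {m} m%2≡1 (s≤s a≤f) = begin
    v₂-aux (suc f) (2 * 2 ^ a * m)   ≡⟨ cong (v₂-aux (suc f)) (ℕₚ.*-assoc 2 (2 ^ a) m) ⟩
    v₂-aux (suc f) (2 * (2 ^ a * m)) ≡⟨ v₂-aux-even f (2 * n) 0<2n 2n%2≡0 2n/2≡n ⟩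
    suc (v₂-aux f n)                 ≡⟨ cong suc (v₂-aux-2^a*odd a f m%2≡1 a≤f) ⟩
    suc a                            ∎
    where
    open ≡-Reasoning
    n : ℕ
    n = 2 ^ a * m
    0<2n : 0 < 2 * n
    0<2n = ℕₚ.*-mono-≤ {1} {2} (s≤s z≤n)
             (ℕₚ.*-mono-≤ {1} {2 ^ a} (ℕₚ.m^n>0 2 a) (odd⇒0< m%2≡1))
    2n%2≡0 : 2 * n % 2 ≡ 0
    2n%2≡0 = trans (cong (_% 2) (ℕₚ.*-comm 2 n)) (m*n%n≡0 n 2)
    2n/2≡n : 2 * n / 2 ≡ n
    2n/2≡n = trans (cong (_/ 2) (ℕₚ.*-comm 2 n)) (m*n/n≡m n 2)

v₂-2^a*odd : ∀ a {m} → m % 2 ≡ 1 → v₂ (2 ^ a * m) ≡ a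
v₂-2^a*odd a {m} m%2≡1 = v₂-aux-2^a*odd a (2 ^ a * m) m%2≡1
  (ℕₚ.<⇒≤ (ℕₚ.<-≤-trans (n<2^n a) (ℕₚ.m≤m*n (2 ^ a) m {{ℕ.>-nonZero (odd⇒0< m%2≡1)}})))

prime≢2⇒odd : ∀ {q} → Prime q → q ≢ 2 → q % 2 ≡ 1
prime≢2⇒odd {q} q-prime q≢2 with q % 2 in eq | m%n<n q 2
... | 1           | _               = refl
... | suc (suc _) | s≤s (s≤s ())
... | 0           | _ with prime⇒irreducible q-prime (m%n≡0⇒n∣m q 2 eq)
...   | inj₁ ()
...   | inj₂ 2≡q = contradiction (sym 2≡q) q≢2

odd-^ : ∀ {q} b → q % 2 ≡ 1 → q ^ b % 2 ≡ 1
odd-^     zero    _     = refl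
odd-^ {q} (suc b) q%2≡1 = begin
  q * q ^ b % 2               ≡⟨ %-distribˡ-* q (q ^ b) 2 ⟩
  (q % 2) * (q ^ b % 2) % 2   ≡⟨ cong₂ (λ u v → u * v % 2) q%2≡1 (odd-^ b q%2≡1) ⟩
  1                           ∎
  where open ≡-Reasoning

∈⇒≤maxList : ∀ {n ns} → n ∈ ns → n ≤ maxList ns
∈⇒≤maxList {ns = m ∷ ms} (here refl)  = ℕₚ.m≤m⊔n m (maxList ms)
∈⇒≤maxList {ns = m ∷ ms} (there n∈ms) =
  ℕₚ.≤-trans (∈⇒≤maxList n∈ms) (ℕₚ.m≤n⊔m m (maxList ms))

maxList≡suc⇒∈ : ∀ {m} ns → maxList ns ≡ suc m → suc m ∈ ns
maxList≡suc⇒∈ (n ∷ ns) eq with ℕₚ.⊔-sel n (maxList ns)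
... | inj₁ n⊔≡n  = here (trans (sym eq) n⊔≡n)
... | inj₂ n⊔≡ns = there (maxList≡suc⇒∈ ns (trans (sym n⊔≡ns) eq))

α₂≡2⇒∃v₂≡2 : ∀ X → α₂ X ≡ 2 → Any (λ x → v₂ x ≡ 2) X
α₂≡2⇒∃v₂≡2 X eq = Any.map sym (Anyₚ.map⁻ (maxList≡suc⇒∈ (map v₂ X) eq))

Is2ᵃqᵇ : ℕ → ℕ → Set
Is2ᵃqᵇ q x = ∃ λ a → ∃ λ b → x ≡ 2 ^ a * q ^ b

monomial : ℕ → ℕ × ℕ → ℕ
monomial q (a , b) = 2 ^ a * q ^ b

All-Is2ᵃqᵇ⇒map-monomial : ∀ {q} X → All (Is2ᵃqᵇ q) X → ∃ λ P → X ≡ map (monomial q) P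
All-Is2ᵃqᵇ⇒map-monomial []      []                        = [] , refl
All-Is2ᵃqᵇ⇒map-monomial (x ∷ X) ((a , b , refl) ∷ forms) with All-Is2ᵃqᵇ⇒map-monomial X forms
... | P , refl = (a , b) ∷ P , refl

private
  product-Is2ᵃqᵇ : ∀ {q} fs → All (λ f → f ≡ 2 ⊎ f ≡ q) fs → Is2ᵃqᵇ q (product fs)
  product-Is2ᵃqᵇ [] [] = 0 , 0 , refl
  product-Is2ᵃqᵇ {q} (f ∷ fs) (f≡2∨q ∷ fs≡2∨q) with product-Is2ᵃqᵇ fs fs≡2∨q | f≡2∨q
  ... | a , b , eq | inj₁ refl =
    suc a , b , trans (cong (2 *_) eq) (sym (ℕₚ.*-assoc 2 (2 ^ a) (q ^ b)))
  ... | a , b , eq | inj₂ refl =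
    a , suc b , trans (cong (q *_) eq) (x∙yz≈y∙xz q (2 ^ a) (q ^ b))

prime-divisors⇒Is2ᵃqᵇ : ∀ q {x} → 0 < x → (∀ r → Prime r → r ∣ x → r ≡ 2 ⊎ r ≡ q) →
  Is2ᵃqᵇ q x
prime-divisors⇒Is2ᵃqᵇ q {x@(suc _)} _ prime-divisors
  with record { factors = fs ; isFactorisation = x≡Πfs ; factorsPrime = fs-prime } ← factorise x
  with a , b , Πfs≡ ← product-Is2ᵃqᵇ fs (All.tabulate λ {f} f∈fs →
         prime-divisors f (All.lookup fs-prime f∈fs) (subst (f ∣_) (sym x≡Πfs) (∈⇒∣product f∈fs)))
  = a , b , trans x≡Πfs Πfs≡

prime-divisors-of-prod⇒All-Is2ᵃqᵇ : ∀ q X → All (0 <_) X →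
  (∀ r → Prime r → r ∣ prod X → r ≡ 2 ⊎ r ≡ q) → All (Is2ᵃqᵇ q) X
prime-divisors-of-prod⇒All-Is2ᵃqᵇ q X X>0 prime-divisors = All.tabulate λ x∈X →
  prime-divisors⇒Is2ᵃqᵇ q (All.lookup X>0 x∈X) λ r r-prime r∣x →
    prime-divisors r r-prime (∣-trans r∣x (∈⇒∣product x∈X))

twoPrimeDivisors⇒Is2ᵃqᵇ : ∀ X → All (0 <_) X → Any (2 ∣_) X →
  ExactlyTwoPrimeDivisors (prod X) → ∃ λ q → Prime q × q ≢ 2 × All (Is2ᵃqᵇ q) X
twoPrimeDivisors⇒Is2ᵃqᵇ X X>0 even (p , q , p-prime , q-prime , p≢q , divisors)
  with Equivalence.to (divisors 2 prime[2]) 2∣ΠX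
  where
  2∣ΠX : 2 ∣ prod X
  2∣ΠX with x , x∈X , 2∣x ← find even = ∣-trans 2∣x (∈⇒∣product x∈X)
... | inj₁ refl = q , q-prime , p≢q ∘ sym , prime-divisors-of-prod⇒All-Is2ᵃqᵇ q X X>0
                    λ r r-prime r∣ΠX → Equivalence.to (divisors r r-prime) r∣ΠX
... | inj₂ refl = p , p-prime , p≢q , prime-divisors-of-prod⇒All-Is2ᵃqᵇ p X X>0
                    λ r r-prime r∣ΠX → swap (Equivalence.to (divisors r r-prime) r∣ΠX)

-- The search tree

twoExponents : List ℕ
twoExponents = 0 ∷ 1 ∷ 2 ∷ []

≤2⇒∈twoExponents : ∀ {a} → a ≤ 2 → a ∈ twoExponents
≤2⇒∈twoExponents z≤n             = here refl
≤2⇒∈twoExponents (s≤s z≤n)       = there (here refl)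
≤2⇒∈twoExponents (s≤s (s≤s z≤n)) = there (there (here refl))

cofactor : (p B : ℕ) → ℕ × ℕ → ℕ
cofactor p B (a , b) = 2 ^ (2 ∸ a) * p ^ (B ∸ b)

-- search p n g r k as lists the exponent pairs of n elements still to be placed, whose
-- cofactors add up to r · p^(B-k), which lie at level k or above, whose exponents of 2 at
-- level k lie in as, and where at most g levels in a row may be passed over.  Because
-- searchLevel p n calls search p (suc n), termination needs --termination-depth=2.
mutual
  search : (p n g r k : ℕ) → List ℕ → List (List (ℕ × ℕ))
  search p zero    g r k as = if does (r ℕ.≟ 0) then [ [] ] else []
  search p (suc n) g r k as =
    if does (r ≤? 4 * suc n) then searchLevel p n g r k as else []

  searchLevel : (p n g r k : ℕ) → List ℕ → List (List (ℕ × ℕ))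
  searchLevel p n g       r k (a ∷ as) =
    (if does (2 ^ (2 ∸ a) ≤? r)
     then map ((a , k) ∷_) (search p n (suc (4 * n)) (r ∸ 2 ^ (2 ∸ a)) k as)
     else [])
    ++ search p (suc n) g r k as
  searchLevel p n zero    r k []       = []
  searchLevel p n (suc g) r k []       = search p (suc n) g (p * r) (suc k) twoExponents

module Completeness (p B : ℕ) {{_ : NonTrivial p}} where

  open import Data.List.Membership.DecPropositional (Productₚ.≡-dec ℕ._≟_ ℕ._≟_) using (_∈?_)

  private
    instance
      p≢0 : NonZero p
      p≢0 = ℕ.nonTrivial⇒nonZero p

    p^≢0 : ∀ e → NonZero (p ^ e)
    p^≢0 e = ℕₚ.m^n≢0 p e

  AtOrAbove : ℕ → List ℕ → ℕ × ℕ → Set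
  AtOrAbove k as (a , b) = k < b ⊎ (b ≡ k × a ∈ as)

  record Valid (k : ℕ) (as : List ℕ) (r : ℕ) (Y : List (ℕ × ℕ)) : Set where
    field
      bounded   : All (λ y → proj₁ y ≤ 2 × proj₂ y ≤ B) Y
      atOrAbove : All (AtOrAbove k as) Y
      unique    : Unique Y
      weight    : sum (map (cofactor p B) Y) ≡ r * p ^ (B ∸ k)

  open Valid

  private
    atOrAbove⇒level≥ : ∀ {k as} y → AtOrAbove k as y → k ≤ proj₂ y
    atOrAbove⇒level≥ _ (inj₁ k<b)        = ℕₚ.<⇒≤ k<b
    atOrAbove⇒level≥ _ (inj₂ (refl , _)) = ℕₚ.≤-refl

    cofactor≤ : ∀ {k as} y → AtOrAbove k as y → cofactor p B y ≤ 4 * p ^ (B ∸ k)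
    cofactor≤ (a , b) h =
      ℕₚ.*-mono-≤ (2^[2∸a]≤4 a) (ℕₚ.^-monoʳ-≤ p (ℕₚ.∸-monoʳ-≤ B (atOrAbove⇒level≥ _ h)))

  valid⇒r≤4*length : ∀ {k as r Y} → Valid k as r Y → r ≤ 4 * length Y
  valid⇒r≤4*length {k} {r = r} {Y} V =
    ℕₚ.*-cancelʳ-≤ r (4 * length Y) (p ^ (B ∸ k)) {{p^≢0 (B ∸ k)}} (begin
      r * p ^ (B ∸ k)              ≡⟨ weight V ⟨
      sum (map (cofactor p B) Y)   ≤⟨ sum-map-≤ (cofactor p B) (All.map (cofactor≤ _) (atOrAbove V)) ⟩
      length Y * (4 * p ^ (B ∸ k)) ≡⟨ ℕₚ.*-assoc (length Y) 4 _ ⟨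
      length Y * 4 * p ^ (B ∸ k)   ≡⟨ cong (_* p ^ (B ∸ k)) (ℕₚ.*-comm (length Y) 4) ⟩
      4 * length Y * p ^ (B ∸ k)   ∎)
    where open ℕₚ.≤-Reasoning

  valid⇒0<r : ∀ {k as r y Y} → Valid k as r (y ∷ Y) → 0 < r
  valid⇒0<r {r = suc _} _ = s≤s z≤n
  valid⇒0<r {r = zero} {y = a , b} {Y} V = begin-strict
    0                                      <⟨ ℕₚ.*-mono-≤ (ℕₚ.m^n>0 2 (2 ∸ a)) (ℕₚ.m^n>0 p (B ∸ b)) ⟩
    cofactor p B (a , b)                   ≤⟨ ℕₚ.m≤m+n _ _ ⟩
    sum (map (cofactor p B) ((a , b) ∷ Y)) ≡⟨ weight V ⟩
    0                                      ∎
    where open ℕₚ.≤-Reasoning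

  private
    atOrAbove-drop : ∀ {k a as} y → AtOrAbove k (a ∷ as) y → y ≢ (a , k) → AtOrAbove k as y
    atOrAbove-drop _ (inj₁ k<b)                _  = inj₁ k<b
    atOrAbove-drop _ (inj₂ (refl , here refl)) y≢ = contradiction refl y≢
    atOrAbove-drop _ (inj₂ (b≡k , there a∈as)) _  = inj₂ (b≡k , a∈as)

    atOrAbove-next : ∀ {k} y → proj₁ y ≤ 2 → AtOrAbove k [] y →
      AtOrAbove (suc k) twoExponents y
    atOrAbove-next (a , b) a≤2 (inj₁ k<b) with ℕₚ.m≤n⇒m<n∨m≡n k<b
    ... | inj₁ 1+k<b = inj₁ 1+k<b
    ... | inj₂ refl  = inj₂ (refl , ≤2⇒∈twoExponents a≤2)

  take-step : ∀ {k a as r Y} → Valid k (a ∷ as) r Y → (a , k) ∈ Y →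
    ∃ λ Y′ → Y ↭ (a , k) ∷ Y′ × 2 ^ (2 ∸ a) ≤ r × Valid k as (r ∸ 2 ^ (2 ∸ a)) Y′
  take-step {k} {a} {as} {r} V ak∈Y with ∈-∃++ ak∈Y
  ... | us , vs , refl with Unique-resp-↭ (↭⇒↭ₛ (shift (a , k) us vs)) (unique V)
  ... | ak∉ ∷ uniq = us ++ vs , π , c≤r , record
    { bounded   = All.tail (All-resp-↭ π (bounded V))
    ; atOrAbove = All.zipWith (λ (h , ak≢y) → atOrAbove-drop _ h (ak≢y ∘ sym))
                    (All.tail (All-resp-↭ π (atOrAbove V)) , ak∉)
    ; unique    = uniq
    ; weight    = m*o+n≡k*o⇒n≡[k∸m]*o (2 ^ (2 ∸ a)) _ r (p ^ (B ∸ k)) split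
    }
    where
    π : us ++ (a , k) ∷ vs ↭ (a , k) ∷ us ++ vs
    π = shift (a , k) us vs
    split : 2 ^ (2 ∸ a) * p ^ (B ∸ k) + sum (map (cofactor p B) (us ++ vs)) ≡
            r * p ^ (B ∸ k)
    split = trans (sym (sum-↭ (↭.map⁺ (cofactor p B) π))) (weight V)
    c≤r : 2 ^ (2 ∸ a) ≤ r
    c≤r = m*o+n≡k*o⇒m≤k (2 ^ (2 ∸ a)) _ r (p ^ (B ∸ k)) {{p^≢0 (B ∸ k)}} split

  skip-step : ∀ {k a as r Y} → Valid k (a ∷ as) r Y → (a , k) ∉ Y → Valid k as r Y
  skip-step V ak∉Y = record
    { bounded   = bounded V
    ; unique    = unique V
    ; weight    = weight V
    ; atOrAbove = All.tabulate λ y∈Y →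
        atOrAbove-drop _ (All.lookup (atOrAbove V) y∈Y) λ { refl → ak∉Y y∈Y }
    }

  advance-step : ∀ {k r y Y} → Valid k [] r (y ∷ Y) →
    Valid (suc k) twoExponents (p * r) (y ∷ Y)
  advance-step {k} {r} {y} {Y} V = record
    { bounded   = bounded V
    ; unique    = unique V
    ; atOrAbove = All.zipWith (λ ((a≤2 , _) , h) → atOrAbove-next _ a≤2 h)
                    (bounded V , atOrAbove V)
    ; weight    = begin
        sum (map (cofactor p B) (y ∷ Y)) ≡⟨ weight V ⟩
        r * p ^ (B ∸ k)                  ≡⟨ cong (λ e → r * p ^ e) (m<n⇒n∸m≡1+n∸1+m k<B) ⟩
        r * (p * p ^ (B ∸ suc k))        ≡⟨ ℕₚ.*-assoc r p _ ⟨
        r * p * p ^ (B ∸ suc k)          ≡⟨ cong (_* p ^ (B ∸ suc k)) (ℕₚ.*-comm r p) ⟩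
        p * r * p ^ (B ∸ suc k)          ∎
    }
    where
    open ≡-Reasoning
    k<B : k < B
    k<B with All.head (bounded V) | All.head (atOrAbove V)
    ... | _ , b≤B | inj₁ k<b = ℕₚ.<-≤-trans k<b b≤B

  private
    r<p*r : ∀ {r} → 0 < r → r < p * r
    r<p*r {r@(suc _)} _ = subst (r <_) (ℕₚ.*-comm r p) (ℕₚ.m<m*n r p (ℕ.nonTrivial⇒n>1 p))

  mutual
    search-complete : ∀ n g {k as r Y} → Valid k as r Y → length Y ≡ n → 4 * n < r + g →
      ∃ λ Q → Q ∈ search p n g r k as × Q ↭ Y
    search-complete zero g {k} {r = r} {Y = []} V refl _ =
      [] , ∈-if (dec-true (r ℕ.≟ 0) r≡0) (here refl) , ↭-refl
      where
      r≡0 : r ≡ 0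
      r≡0 = ℕₚ.m*n≡0⇒m≡0 r _ {{p^≢0 (B ∸ k)}} (sym (weight V))
    search-complete (suc n) g {r = r} V len inv
      with Q , Q∈ , Q↭Y ← level-complete n g V len inv
      = Q , ∈-if (dec-true (r ≤? 4 * suc n) (subst (λ m → r ≤ 4 * m) len (valid⇒r≤4*length V))) Q∈
      , Q↭Y

    level-complete : ∀ n g {k as r Y} → Valid k as r Y → length Y ≡ suc n → 4 * suc n < r + g →
      ∃ λ Q → Q ∈ searchLevel p n g r k as × Q ↭ Y
    level-complete n zero {as = []} {r} V len inv =
      contradiction (subst (λ m → r ≤ 4 * m) len (valid⇒r≤4*length V))
                    (ℕₚ.<⇒≱ (subst (4 * suc n <_) (ℕₚ.+-identityʳ r) inv))
    level-complete n (suc g) {as = []} {r} {_ ∷ _} V len inv =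
      search-complete (suc n) g (advance-step V) len (begin-strict
        4 * suc n   <⟨ inv ⟩
        r + suc g   ≡⟨ ℕₚ.+-suc r g ⟩
        suc r + g   ≤⟨ ℕₚ.+-monoˡ-≤ g (r<p*r (valid⇒0<r V)) ⟩
        p * r + g   ∎)
      where open ℕₚ.≤-Reasoning
    level-complete n g {k} {a ∷ as} {r} {Y} V len inv with (a , k) ∈? Y
    ... | yes ak∈Y
      with Y′ , Y↭ , c≤r , V′ ← take-step V ak∈Y
      with Q′ , Q′∈ , Q′↭Y′ ← search-complete n (suc (4 * n)) V′
                                (ℕₚ.suc-injective (trans (sym (↭-length Y↭)) len))
                                (m<n+1+m (4 * n) (r ∸ 2 ^ (2 ∸ a)))
      = (a , k) ∷ Q′
      , ∈-++⁺ˡ (∈-if (dec-true (2 ^ (2 ∸ a) ≤? r) c≤r) (∈-map⁺ ((a , k) ∷_) Q′∈))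
      , ↭-trans (↭-prep (a , k) Q′↭Y′) (↭-sym Y↭)
    ... | no ak∉Y
      with Q , Q∈ , Q↭Y ← search-complete (suc n) g (skip-step V ak∉Y) len inv
      = Q , ∈-++⁺ʳ _ Q∈ , Q↭Y

  valid⇒length≤ : ∀ {k as r Y} → 4 * length Y < p → Valid k as r Y → length Y ≤ length as
  valid⇒length≤ {Y = []} _ _ = z≤n
  valid⇒length≤ {as = []} {r} {Y@(_ ∷ _)} 4|Y|<p V = contradiction (begin-strict
    p * r         ≤⟨ valid⇒r≤4*length (advance-step V) ⟩
    4 * length Y  <⟨ 4|Y|<p ⟩
    p             ≤⟨ ℕₚ.m≤m*n p r {{ℕ.>-nonZero (valid⇒0<r V)}} ⟩
    p * r         ∎) (ℕₚ.<-irrefl refl)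
    where open ℕₚ.≤-Reasoning
  valid⇒length≤ {k} {a ∷ as} {Y = Y@(_ ∷ _)} 4|Y|<p V with (a , k) ∈? Y
  ... | yes ak∈Y
    with Y′ , Y↭ , _ , V′ ← take-step V ak∈Y
    = subst (_≤ suc (length as)) |Y|≡1+|Y′| (s≤s (valid⇒length≤ 4|Y′|<p V′))
    where
    |Y|≡1+|Y′| : suc (length Y′) ≡ length Y
    |Y|≡1+|Y′| = sym (↭-length Y↭)
    4|Y′|<p : 4 * length Y′ < p
    4|Y′|<p = ℕₚ.≤-<-trans (ℕₚ.*-monoʳ-≤ 4 (subst (length Y′ ≤_) |Y|≡1+|Y′| (ℕₚ.n≤1+n _)))
                           4|Y|<p
  ... | no ak∉Y = ℕₚ.m≤n⇒m≤1+n (valid⇒length≤ 4|Y|<p (skip-step V ak∉Y))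

-- From a solution to a leaf of the search tree

maxLevel : List (ℕ × ℕ) → ℕ
maxLevel P = maxList (map proj₂ P)

module _ (q : ℕ) {{_ : NonTrivial q}} (q-odd : q % 2 ≡ 1) where

  monomial*cofactor : ∀ B y → proj₁ y ≤ 2 → proj₂ y ≤ B →
    monomial q y * cofactor q B y ≡ 4 * q ^ B
  monomial*cofactor B (a , b) a≤2 b≤B = begin
    2 ^ a * q ^ b * (2 ^ (2 ∸ a) * q ^ (B ∸ b))
      ≡⟨ interchange (2 ^ a) (q ^ b) _ _ ⟩
    2 ^ a * 2 ^ (2 ∸ a) * (q ^ b * q ^ (B ∸ b))
      ≡⟨ cong₂ _*_ (ℕₚ.^-distribˡ-+-* 2 a _) (ℕₚ.^-distribˡ-+-* q b _) ⟨
    2 ^ (a + (2 ∸ a)) * q ^ (b + (B ∸ b))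
      ≡⟨ cong₂ (λ i j → 2 ^ i * q ^ j) (ℕₚ.m+[n∸m]≡n a≤2) (ℕₚ.m+[n∸m]≡n b≤B) ⟩
    4 * q ^ B ∎
    where open ≡-Reasoning

  solution⇒valid : ∀ P → IsSolution (map (monomial q) P) → α₂ (map (monomial q) P) ≡ 2 →
    Completeness.Valid q (maxLevel P) 0 twoExponents 4 P
  solution⇒valid P (_ , unique , positive , recipSum≡1) α₂≡2 = record
    { bounded   = bounded
    ; atOrAbove = All.map atOrAbove bounded
    ; unique    = map⁻ unique
    ; weight    = recipSum≡1⇒sum-cofactors≡ (monomial q) (cofactor q (maxLevel P)) P
                    (All.map (λ {y} (a≤2 , b≤B) → monomial*cofactor (maxLevel P) y a≤2 b≤B)
                       bounded)
                    positive recipSum≡1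
    }
    where
    bounded : All (λ y → proj₁ y ≤ 2 × proj₂ y ≤ maxLevel P) P
    bounded = All.tabulate λ {(a , b)} y∈P →
        subst (_≤ 2) (v₂-2^a*odd a (odd-^ b q-odd))
          (subst (v₂ (monomial q (a , b)) ≤_) α₂≡2
            (∈⇒≤maxList (∈-map⁺ v₂ (∈-map⁺ (monomial q) y∈P))))
      , ∈⇒≤maxList (∈-map⁺ proj₂ y∈P)
    atOrAbove : ∀ {y} → proj₁ y ≤ 2 × proj₂ y ≤ maxLevel P →
      Completeness.AtOrAbove q (maxLevel P) 0 twoExponents y
    atOrAbove {a , zero}  (a≤2 , _) = inj₂ (refl , ≤2⇒∈twoExponents a≤2)
    atOrAbove {a , suc b} _         = inj₁ (s≤s z≤n)

-- The cofactors of a solution add up to 4 q^B, i.e. to 4 · q^(B-0) at level 0.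
candidates : ℕ → List (List ℕ)
candidates q = map (map (monomial q)) (search q 9 (suc (4 * 9)) 4 0 twoExponents)

module _ (q : ℕ) {{_ : NonTrivial q}} (P : List (ℕ × ℕ)) (|P|≡9 : length P ≡ 9) where
  open Completeness q (maxLevel P)

  valid⇒q<37 : Valid 0 twoExponents 4 P → q < 37
  valid⇒q<37 V = ℕₚ.≰⇒> λ 37≤q → contradiction
    (subst (_≤ 3) |P|≡9 (valid⇒length≤ (subst (λ n → 4 * n < q) (sym |P|≡9) 37≤q) V))
    λ { (s≤s (s≤s (s≤s ()))) }

  valid⇒candidate : Valid 0 twoExponents 4 P →
    ∃ λ N → N ∈ candidates q × map (monomial q) P ↭ N
  valid⇒candidate V =
    let Q , Q∈ , Q↭P = search-complete 9 (suc (4 * 9)) V |P|≡9 (ℕₚ.m≤n+m (suc (4 * 9)) 4)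
    in  map (monomial q) Q , ∈-map⁺ (map (monomial q)) Q∈ , ↭.map⁺ (monomial q) (↭-sym Q↭P)

solution⇒candidate : ∀ q {{_ : NonTrivial q}} → q % 2 ≡ 1 →
  ∀ X → IsSolution X → α₂ X ≡ 2 → All (Is2ᵃqᵇ q) X →
  q < 37 × ∃ λ N → N ∈ candidates q × X ↭ N
solution⇒candidate q q-odd X solution α₂≡2 forms =
  let P , X≡ = All-Is2ᵃqᵇ⇒map-monomial X forms
      solution′ : IsSolution (map (monomial q) P)
      solution′ = subst IsSolution X≡ solution
      |P|≡9 : length P ≡ 9
      |P|≡9 = trans (sym (Listₚ.length-map (monomial q) P)) (proj₁ solution′)
      V : Completeness.Valid q (maxLevel P) 0 twoExponents 4 P
      V = solution⇒valid q q-odd P solution′ (subst (λ Y → α₂ Y ≡ 2) X≡ α₂≡2)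
      N , N∈ , P↭N = valid⇒candidate q P |P|≡9 V
  in  valid⇒q<37 q P |P|≡9 V , N , N∈ , subst (_↭ N) (sym X≡) P↭N

open import Data.List.Membership.DecPropositional ℕ._≟_ using (_∈?_)

-- The sets of the statement are listed in increasing order, so sorting a candidate is
-- enough to recognise it.
Classified : (List ℕ → Set) → List (List ℕ) → List ℕ → Set
Classified Side Ls N = Side N → Any (λ x → v₂ x ≡ 2) N → Any (λ L → sort N ≡ L) Ls

classified? : ∀ {Side} → Decidable Side → ∀ Ls → Decidable (Classified Side Ls)
classified? side? Ls N =
  side? N →-dec any? (λ x → v₂ x ℕ.≟ 2) N →-dec any? (λ L → Listₚ.≡-dec ℕ._≟_ (sort N) L) Ls

Certified : (List ℕ → Set) → List (List ℕ) → ℕ → Set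
Certified Side Ls q = All (Classified Side Ls) (candidates q)

classify : ∀ {Side : List ℕ → Set} Ls → (∀ {Y Z} → Y ↭ Z → Side Y → Side Z) →
  ∀ q → Prime q → q ≢ 2 → (q < 37 → Certified Side Ls q) →
  ∀ X → IsSolution X → α₂ X ≡ 2 → All (Is2ᵃqᵇ q) X → Side X → Any (X ↭_) Ls
classify Ls Side-resp-↭ q q-prime q≢2 certified X solution α₂≡2 forms side =
  let q<37 , N , N∈ , X↭N = solution⇒candidate q {{prime⇒nonTrivial q-prime}}
                              (prime≢2⇒odd q-prime q≢2) X solution α₂≡2 forms
  in  Any.map (λ sortN≡L → ↭-trans X↭N (↭-trans (↭-sym (sort-↭ N)) (↭-reflexive sortN≡L)))
        (All.lookup (certified q<37) N∈ (Side-resp-↭ X↭N side)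
          (Any-resp-↭ X↭N (α₂≡2⇒∃v₂≡2 X α₂≡2)))

certificate-i : All (λ q → Prime q → q ≢ 2 → Certified (2 ∉_) listI q) (upTo 37)
certificate-i = toWitness {a? = all? (λ q → prime? q →-dec ¬? (q ℕ.≟ 2) →-dec
  all? (classified? (λ N → ¬? (2 ∈? N)) listI) (candidates q)) (upTo 37)} _

certificate-iiq : All (λ q → Prime q → q ≢ 2 → q ≢ 3 → Certified (2 ∈_) listIIq q) (upTo 37)
certificate-iiq = toWitness {a? = all? (λ q → prime? q →-dec ¬? (q ℕ.≟ 2) →-dec ¬? (q ℕ.≟ 3)
  →-dec all? (classified? (2 ∈?_) listIIq) (candidates q)) (upTo 37)} _

certificate-ii3 : Certified (2 ∈_) listII3 3
certificate-ii3 = toWitness {a? = all? (classified? (2 ∈?_) listII3) (candidates 3)} _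

isSolution? : Decidable IsSolution
isSolution? X = length X ℕ.≟ 9 ×-dec unique? X ×-dec all? (0 <?_) X ×-dec recipSum X ℚₚ.≟ 1ℚ

classification-i : ∀ X → IsSolution X → Any (2 ∣_) X → 2 ∉ X → α₂ X ≡ 2 →
  ExactlyTwoPrimeDivisors (prod X) → Any (X ↭_) listI
classification-i X solution even 2∉X α₂≡2 twoPrimes =
  let _ , _ , positive , _ = solution
      q , q-prime , q≢2 , forms = twoPrimeDivisors⇒Is2ᵃqᵇ X positive even twoPrimes
  in  classify listI (λ X↭Y 2∉X → 2∉X ∘ ∈-resp-↭ (↭-sym X↭Y)) q q-prime q≢2
        (λ q<37 → All.lookup certificate-i (∈-upTo⁺ q<37) q-prime q≢2) X solution α₂≡2 forms 2∉X

classification-iiq : ∀ X → IsSolution X → 2 ∈ X → α₂ X ≡ 2 →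
  ∀ q → Prime q → q ≢ 2 → q ≢ 3 → All (Is2ᵃqᵇ q) X → Any (X ↭_) listIIq
classification-iiq X solution 2∈X α₂≡2 q q-prime q≢2 q≢3 forms =
  classify listIIq ∈-resp-↭ q q-prime q≢2
    (λ q<37 → All.lookup certificate-iiq (∈-upTo⁺ q<37) q-prime q≢2 q≢3) X solution α₂≡2 forms 2∈X

classification-ii3 : ∀ X → IsSolution X → 2 ∈ X → α₂ X ≡ 2 → All (Is2ᵃqᵇ 3) X → Any (X ↭_) listII3
classification-ii3 X solution 2∈X α₂≡2 forms =
  classify listII3 ∈-resp-↭ 3 (toWitness {a? = prime? 3} _) (λ ()) (λ _ → certificate-ii3)
    X solution α₂≡2 forms 2∈X

listI-solutions : All IsSolution listI
listI-solutions = toWitness {a? = all? isSolution? listI} _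

listIIq-solutions : All IsSolution listIIq
listIIq-solutions = toWitness {a? = all? isSolution? listIIq} _

listII3-solutions : All IsSolution listII3
listII3-solutions = toWitness {a? = all? isSolution? listII3} _

lemma4 :
    -- (i)
    (((X : List ℕ) → IsSolution X → Any (λ x → 2 ∣ x) X →
        ¬ (2 ∈ X) → α₂ X ≡ 2 → ExactlyTwoPrimeDivisors (prod X) →
        Any (λ L → X ↭ L) listI)
     × All IsSolution listI)
    ×
    -- (ii)
    (((X : List ℕ) → IsSolution X → Any (λ x → 2 ∣ x) X →
        2 ∈ X → α₂ X ≡ 2 →
        (((q : ℕ) → Prime q → ¬ (q ≡ 2) → ¬ (q ≡ 3) →
            All (λ x → ∃ λ a → ∃ λ b → x ≡ 2 ^ a * q ^ b) X →
            Any (λ L → X ↭ L) listIIq)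
         × (All (λ x → ∃ λ a → ∃ λ b → x ≡ 2 ^ a * 3 ^ b) X →
            Any (λ L → X ↭ L) listII3)))
     × All IsSolution listIIq
     × All IsSolution listII3)
lemma4 =
  ( (classification-i , listI-solutions)
  , ( (λ X solution _ 2∈X α₂≡2 → classification-iiq X solution 2∈X α₂≡2
                                , classification-ii3 X solution 2∈X α₂≡2)
    , listIIq-solutions
    , listII3-solutions
    )
  )
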